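{- For every broadcast protocol $P=(Q,\Sigma,q_{in},\Delta)$ and every state $q_f\in Q$: $q_f$ is coverable with some topology if and only if $q_f$ is coverable with some tree topology. In other words, the problems $\textsc{Cover}[\textsf{Graphs}]$ and $\textsc{Cover}[\textsf{Trees}]$ have the same positive instances.
   Context: A broadcast protocol is a tuple $P=(Q,\Sigma,q_{in},\Delta)$ where $Q$ is a finite set of states, $\Sigma$ a finite alphabet of messages, $q_{in}\in Q$ the initial state and $\Delta\subseteq Q\times(\{!!m: m\in\Sigma\}\cup\{?m : m\in\Sigma\}\cup\{\tau\})\times Q$ a finite set of transitions ($!!m$ = broadcast of $m$, $?m$ = reception of $m$, $\tau$ = internal action). For $q\in Q$ let $R(q)=\{m\in\Sigma:\exists q',\ (q,?m,q')\in\Delta\}$. A topology is a finite undirected graph $\Gamma=(V,E)$ without self-loops; $N(v)$ denotes the set of neighbours of $v$. A configuration is a pair $(\Gamma,L)$ with $L:V\to Q$; it is initial if $L(v)=q_{in}$ for all $v$. For configurations $C=(\Gamma,L)$, $C'=(\Gamma,L')$ over the same topology, a vertex $v$ and $\delta=(q,\alpha,q')\in\Delta$, we write $C\xrightarrow{v,\delta}C'$ if $L(v)=q$, $L'(v)=q'$ and either $\alpha=\tau$ and $L'(u)=L(u)$ for all $u\neq v$; or $\alpha=!!m$, and for every $u\in N(v)$ either $(L(u),?m,L'(u))\in\Delta$ or ($m\notin R(L(u))$ and $L'(u)=L(u)$), and $L'(w)=L(w)$ for all $w\notin\{v\}\cup N(v)$. Write $C\to C'$ if $C\xrightarrow{v,\delta}C'$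 for some $v,\delta$, and $\to^*$ for the reflexive transitive closure. A state $q_f$ is coverable with topology $\Gamma$ if there exist an initial configuration $C=(\Gamma,L)$ and a configuration $C'=(\Gamma,L')$ with $C\to^* C'$ and $L'(v)=q_f$ for some vertex $v$. A tree topology is one whose vertex set $V$ is a finite prefix-closed subset of $\mathbb{N}^*$ containing the empty word $\epsilon$, with edges exactly between $w$ and $w[-1]$ for every $w\in V\setminus\{\epsilon\}$ ($w[-1]$ is $w$ with its last letter removed). For a family $\mathcal{S}$ of topologies, $\textsc{Cover}[\mathcal{S}]$ asks, given $P$ and $q_f$, whether $q_f$ is coverable with some $\Gamma\in\mathcal{S}$; $\textsf{Graphs}$ is the family of all topologies and $\textsf{Trees}$ the family of tree topologies. -}

module Defs where

open import Data.Nat using (ℕ)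
open import Data.Fin using (Fin)
open import Data.Bool using (Bool; true; false; _∨_; _∧_; not)
open import Data.List using (List; []; _∷_; _++_; length; lookup)
open import Data.List.Properties using (≡-dec)
open import Data.List.Membership.Propositional using (_∈_)
open import Data.List.Relation.Unary.Unique.Propositional using (Unique)
open import Data.Product using (Σ; ∃; _×_; _,_)
open import Data.Sum using (_⊎_)
open import Data.Empty using (⊥)
open import Relation.Nullary using (¬_; Dec; yes; no)
open import Relation.Nullary.Decidable using (⌊_⌋)
open import Relation.Binary.PropositionalEquality using (_≡_; _≢_)
open import Relation.Binary.Construct.Closure.ReflexiveTransitive using (Star)
import Data.Nat.Properties as ℕP

data Action (nΣ : ℕ) : Set where
  bcast : Fin nΣ → Action nΣ
  recv  : Fin nΣ → Action nΣ
  tau   : Action nΣ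

record Protocol : Set where
  field
    nQ  : ℕ
    nΣ  : ℕ
    qin : Fin nQ
    Δ   : List (Fin nQ × Action nΣ × Fin nQ)

open Protocol public

Receivable : (P : Protocol) → Fin (nQ P) → Fin (nΣ P) → Set
Receivable P q m = ∃ λ q' → (q , recv m , q') ∈ Δ P

record Graph : Set where
  field
    nV  : ℕ
    adj : Fin nV → Fin nV → Bool

open Graph public

IsTopology : Graph → Set
IsTopology Γ = (∀ u v → adj Γ u v ≡ adj Γ v u) × (∀ v → adj Γ v v ≡ false)

Labelling : Protocol → Graph → Set
Labelling P Γ = Fin (nV Γ) → Fin (nQ P)

Step : (P : Protocol) (Γ : Graph) → Labelling P Γ → Labelling P Γ → Set
Step P Γ L L' = Σ (Fin (nV Γ)) λ v →
  Σ (Fin (nQ P) × Action (nΣ P) × Fin (nQ P)) λ δ → δ ∈ Δ P × StepBy v δ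
  where
  StepBy : Fin (nV Γ) → Fin (nQ P) × Action (nΣ P) × Fin (nQ P) → Set
  StepBy v (q , tau , q') =
    L v ≡ q × L' v ≡ q' × (∀ u → u ≢ v → L' u ≡ L u)
  StepBy v (q , recv m , q') = ⊥   -- a reception transition alone is not a step
  StepBy v (q , bcast m , q') =
    L v ≡ q × L' v ≡ q'
    × (∀ u → adj Γ v u ≡ true →
          ((L u , recv m , L' u) ∈ Δ P)
        ⊎ (¬ Receivable P (L u) m × L' u ≡ L u))
    × (∀ w → w ≢ v → adj Γ v w ≡ false → L' w ≡ L w)

Reach : (P : Protocol) (Γ : Graph) → Labelling P Γ → Labelling P Γ → Set
Reach P Γ = Star (Step P Γ)

CoverableWith : (P : Protocol) → Fin (nQ P) → Graph → Set
CoverableWith P qf Γ = Σ (Labelling P Γ) λ L' →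
  Reach P Γ (λ _ → qin P) L' × (∃ λ v → L' v ≡ qf)

dropLast : List ℕ → List ℕ
dropLast []           = []
dropLast (x ∷ [])     = []
dropLast (x ∷ y ∷ w)  = x ∷ dropLast (y ∷ w)

record TreeVertices : Set where
  field
    V            : List (List ℕ)
    unique       : Unique V
    hasRoot      : [] ∈ V
    prefixClosed : ∀ w → w ∈ V → ∀ u v → w ≡ u ++ v → u ∈ V

open TreeVertices public

isChildOf : List ℕ → List ℕ → Bool
isChildOf [] b      = false
isChildOf (x ∷ a) b = ⌊ ≡-dec ℕP._≟_ b (dropLast (x ∷ a)) ⌋

treeTopology : TreeVertices → Graph
treeTopology T = record
  { nV  = length (V T)
  ; adj = λ i j → isChildOf (lookup (V T) i) (lookup (V T) j)
                  ∨ isChildOf (lookup (V T) j) (lookup (V T) i)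
  }

CoverGraphs : (P : Protocol) → Fin (nQ P) → Set
CoverGraphs P qf = Σ Graph λ Γ → IsTopology Γ × CoverableWith P qf Γ

CoverTrees : (P : Protocol) → Fin (nQ P) → Set
CoverTrees P qf = Σ TreeVertices λ T → CoverableWith P qf (treeTopology T)

module Submission where

-- Tree topologies are topologies, so only graphs ⇒ trees needs an argument. Let a run of length K
-- on Γ cover q_f at c, and unfold Γ from c into the tree of non-backtracking walks of length ≤ K,
-- each walk standing for its endpoint. Up to depth K this is a local isomorphism onto Γ: adjacent
-- walks end in adjacent vertices, distinct neighbours of a walk end in distinct vertices, and every
-- neighbour of an endpoint is the endpoint of a neighbouring walk at most one level deeper.
-- Suppose every vertex of depth ≤ d + 1 carries the label of its image. A step of Γ at v is replayed
-- on the tree by letting every copy of v of depth ≤ d + 1 perform the same transition, one after the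
-- other. Copies of v are pairwise non-adjacent and have disjoint neighbourhoods, so they do not
-- interfere, and afterwards every vertex of depth ≤ d carries the new label of its image. Each step
-- thus costs one level; after K steps the root, a copy of c, is labelled q_f.

open import Defs
open import Data.Bool using (true; false; _∨_; if_then_else_)
open import Data.Bool.Properties using (∨-comm; ∨-zeroʳ; not-¬; ¬-not) renaming (_≟_ to _≟ᵇ_)
open import Data.Fin using (Fin; toℕ; _≟_)
open import Data.Fin.Properties using (toℕ-injective; any?)
open import Data.List
  using (List; []; _∷_; _++_; _∷ʳ_; [_]; length; lookup; map; filter; allFin; deduplicate;
         cartesianProductWith; initLast; _∷ʳ′_)
open import Data.List.Properties
  using (∷ʳ-injective; ∷ʳ-injectiveˡ; ++-assoc; ++-identityʳ; ++-identityʳ-unique; ++-conicalʳ)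
  renaming (≡-dec to ≡-decᴸ)
open import Data.List.Membership.Propositional using (_∈_; _∉_; find; lose)
open import Data.List.Membership.Propositional.Properties
  using (∈-filter⁺; ∈-allFin; ∈-map⁺; ∈-map⁻; ∈-lookup; ∈-deduplicate⁺; ∈-deduplicate⁻;
         ∈-cartesianProductWith⁺; ∈-cartesianProductWith⁻)
open import Data.List.Relation.Unary.Any as Any using (Any; here; there; index)
open import Data.List.Relation.Unary.Any.Properties using (lookup-index)
open import Data.List.Relation.Unary.All as All using (All; []; _∷_)
open import Data.List.Relation.Unary.All.Properties using (all-filter; All¬⇒¬Any)
open import Data.List.Relation.Unary.Unique.Propositional using (Unique; []; _∷_)
open import Data.List.Relation.Unary.Unique.Propositional.Properties using (filter⁺; allFin⁺; map⁺)
import Data.List.Relation.Unary.Unique.DecPropositional.Properties as UniqueDec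
open import Data.Nat using (ℕ; zero; suc; _≤_; _<_; _≤?_; z≤n; s≤s) renaming (_≟_ to _≟ℕ_)
open import Data.Nat.Properties using (≤-refl; ≤-reflexive; ≤-trans; ≤-<-trans; <⇒≤; m≤n⇒m≤1+n; 1+n≰n)
open import Data.Product using (∃; _×_; _,_; proj₁; proj₂)
open import Data.Product.Properties using () renaming (≡-dec to ≡-decˣ)
open import Data.Sum using (_⊎_; inj₁; inj₂; [_,_]′)
open import Data.Vec.Functional using (updateAt)
open import Data.Vec.Functional.Properties using (updateAt-updates; updateAt-minimal)
open import Function using (_∘_; const)
open import Function.Bundles using (_⇔_; mk⇔)
open import Relation.Binary.Definitions using (DecidableEquality)
open import Relation.Binary.PropositionalEquality
  using (_≡_; _≢_; refl; sym; trans; cong; cong₂; subst; subst₂; module ≡-Reasoning)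
open import Relation.Binary.Construct.Closure.ReflexiveTransitive using (Star; ε; _◅_; _◅◅_)
open import Relation.Nullary using (¬_; Dec; yes; no; contradiction)
open import Relation.Nullary.Decidable using (_×-dec_; _⊎-dec_; ¬?; map′)
open import Relation.Unary using (Decidable)

∷ʳ≢[] : ∀ {A : Set} {xs : List A} {x} → xs ∷ʳ x ≢ []
∷ʳ≢[] {xs = xs} e with () ← ++-conicalʳ xs _ e

lookup-injective : ∀ {A : Set} {xs : List A} → Unique xs → ∀ i j → lookup xs i ≡ lookup xs j → i ≡ j
lookup-injective (_ ∷ _)      Fin.zero    Fin.zero    _ = refl
lookup-injective (x∉xs ∷ _)   Fin.zero    (Fin.suc j) e = contradiction e (All.lookup x∉xs (∈-lookup j))
lookup-injective (x∉xs ∷ _)   (Fin.suc i) Fin.zero    e = contradiction (sym e) (All.lookup x∉xs (∈-lookup i))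
lookup-injective (_ ∷ unique) (Fin.suc i) (Fin.suc j) e = cong Fin.suc (lookup-injective unique i j e)

∨≡true⁻ : ∀ b₁ b₂ → b₁ ∨ b₂ ≡ true → b₁ ≡ true ⊎ b₂ ≡ true
∨≡true⁻ true  _ _ = inj₁ refl
∨≡true⁻ false _ e = inj₂ e

steps : ∀ {A : Set} {R : A → A → Set} {x y} → Star R x y → ℕ
steps ε       = 0
steps (_ ◅ r) = suc (steps r)

_≟ₐ_ : ∀ {n} → DecidableEquality (Action n)
bcast m ≟ₐ bcast m′ = map′ (cong bcast) (λ { refl → refl }) (m ≟ m′)
recv m  ≟ₐ recv m′  = map′ (cong recv) (λ { refl → refl }) (m ≟ m′)
tau     ≟ₐ tau      = yes refl
bcast _ ≟ₐ recv _   = no λ ()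
bcast _ ≟ₐ tau      = no λ ()
recv _  ≟ₐ bcast _  = no λ ()
recv _  ≟ₐ tau      = no λ ()
tau     ≟ₐ bcast _  = no λ ()
tau     ≟ₐ recv _   = no λ ()

module _ (P : Protocol) where

  private
    State   = Fin (nQ P)
    Message = Fin (nΣ P)

  ∈Δ? : (δ : State × Action (nΣ P) × State) → Dec (δ ∈ Δ P)
  ∈Δ? δ = Any.any? (≡-decˣ _≟_ (≡-decˣ _≟ₐ_ _≟_) δ) (Δ P)

  receivable? : ∀ s m → Dec (Receivable P s m)
  receivable? s m = any? (λ s′ → ∈Δ? (s , recv m , s′))

  Reacts : Message → State → State → Set
  Reacts m s s′ = ((s , recv m , s′) ∈ Δ P) ⊎ (¬ Receivable P s m × s′ ≡ s)

  reacts? : ∀ m s s′ → Dec (Reacts m s s′)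
  reacts? m s s′ = ∈Δ? (s , recv m , s′) ⊎-dec (¬? (receivable? s m) ×-dec s′ ≟ s)

  reaction : ∀ m s → ∃ (Reacts m s)
  reaction m s with receivable? s m
  ... | yes (s′ , δ∈) = s′ , inj₁ δ∈
  ... | no ¬receivable = s , inj₂ (¬receivable , refl)

  reactTowards : Message → State → State → State
  reactTowards m s t with reacts? m s t
  ... | yes _ = t
  ... | no _  = proj₁ (reaction m s)

  reactTowards-reacts : ∀ m s t → Reacts m s (reactTowards m s t)
  reactTowards-reacts m s t with reacts? m s t
  ... | yes s↝t = s↝t
  ... | no _    = proj₂ (reaction m s)

  reactTowards-target : ∀ {m s t} → Reacts m s t → reactTowards m s t ≡ t
  reactTowards-target {m} {s} {t} s↝t with reacts? m s t
  ... | yes _   = refl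
  ... | no ¬s↝t = contradiction s↝t ¬s↝t

dropLast-∷ʳ : ∀ w (a : ℕ) → dropLast (w ∷ʳ a) ≡ w
dropLast-∷ʳ []          a = refl
dropLast-∷ʳ (x ∷ [])    a = refl
dropLast-∷ʳ (x ∷ y ∷ w) a = cong (x ∷_) (dropLast-∷ʳ (y ∷ w) a)

isChildOf⇒dropLast : ∀ w u → isChildOf w u ≡ true → u ≡ dropLast w
isChildOf⇒dropLast (x ∷ w) u _ with ≡-decᴸ _≟ℕ_ u (dropLast (x ∷ w))
... | yes u≡ = u≡

isChildOf-∷ʳ : ∀ u a → isChildOf (u ∷ʳ a) u ≡ true
isChildOf-∷ʳ []      a = refl
isChildOf-∷ʳ (x ∷ u) a with ≡-decᴸ _≟ℕ_ (x ∷ u) (dropLast (x ∷ u ∷ʳ a))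
... | yes _ = refl
... | no ≢  = contradiction (sym (dropLast-∷ʳ (x ∷ u) a)) ≢

isChildOf⇒∷ʳ : ∀ w u → isChildOf w u ≡ true → ∃ λ a → w ≡ u ∷ʳ a
isChildOf⇒∷ʳ w u isChild with initLast w
... | []      = contradiction isChild λ ()
... | w′ ∷ʳ′ a =
  a , cong (_∷ʳ a) (sym (trans (isChildOf⇒dropLast (w′ ∷ʳ a) u isChild) (dropLast-∷ʳ w′ a)))

isChildOf-irreflexive : ∀ w → isChildOf w w ≡ false
isChildOf-irreflexive w = ¬-not λ isChild →
  contradiction (++-identityʳ-unique w (proj₂ (isChildOf⇒∷ʳ w w isChild))) λ ()

treeTopology-isTopology : ∀ T → IsTopology (treeTopology T)
treeTopology-isTopology T =
    (λ i j → ∨-comm (isChildOf (lookup (V T) i) (lookup (V T) j)) _)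
  , (λ i → cong (λ b → b ∨ b) (isChildOf-irreflexive (lookup (V T) i)))

record BoundedCover (K : ℕ) (T Γ : Graph) : Set where
  field
    π     : Fin (nV T) → Fin (nV Γ)
    depth : Fin (nV T) → ℕ
    π-adjacent : ∀ {x y} → depth x ≤ K → depth y ≤ K →
                 adj T x y ≡ true → adj Γ (π x) (π y) ≡ true
    π-locallyInjective : ∀ {x x′ y} → depth x ≤ K → depth x′ ≤ K →
                         adj T x y ≡ true → adj T x′ y ≡ true → π x ≡ π x′ → x ≡ x′
    π-liftsNeighbours : ∀ {y u} → depth y < K → adj Γ u (π y) ≡ true →
                        ∃ λ x → adj T x y ≡ true × π x ≡ u × depth x ≤ suc (depth y)

module Simulation (P : Protocol) {K : ℕ} {T Γ : Graph} (cover : BoundedCover K T Γ)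
                  (T-loopless : ∀ x → adj T x x ≡ false)
                  (Γ-loopless : ∀ u → adj Γ u u ≡ false) where

  open BoundedCover cover

  Agrees : ℕ → Labelling P Γ → Labelling P T → Set
  Agrees d L M = ∀ y → depth y ≤ d → M y ≡ L (π y)

  module Replay {d : ℕ} (d<K : d < K) (L L′ : Labelling P Γ) (v : Fin (nV Γ)) where

    Copy : Fin (nV T) → Set
    Copy x = π x ≡ v × depth x ≤ suc d

    copy? : Decidable Copy
    copy? x = π x ≟ v ×-dec depth x ≤? suc d

    copies : List (Fin (nV T))
    copies = filter copy? (allFin _)

    copies-unique : Unique copies
    copies-unique = filter⁺ copy? (allFin⁺ _)

    copies-areCopies : All Copy copies
    copies-areCopies = all-filter copy? (allFin _)

    ∈-copies⁺ : ∀ {x} → Copy x → x ∈ copies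
    ∈-copies⁺ {x} = ∈-filter⁺ copy? (∈-allFin x)

    ∈-copies⁻ : ∀ {x} → x ∈ copies → Copy x
    ∈-copies⁻ = All.lookup copies-areCopies

    inRange : ∀ {x} → depth x ≤ suc d → depth x ≤ K
    inRange dx = ≤-trans dx d<K

    copy-adjacent : ∀ {x y} → Copy x → depth y ≤ suc d → adj T x y ≡ true → adj Γ v (π y) ≡ true
    copy-adjacent (πx≡v , dx) dy xy =
      subst (λ u → adj Γ u _ ≡ true) πx≡v (π-adjacent (inRange dx) (inRange dy) xy)

    copies-nonadjacent : ∀ {x x′} → Copy x → Copy x′ → adj T x x′ ≢ true
    copies-nonadjacent cx (πx′≡v , dx′) xx′ =
      not-¬ (Γ-loopless v) (subst (λ u → adj Γ v u ≡ true) πx′≡v (copy-adjacent cx dx′ xx′))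

    module Firing (Zone : Fin (nV T) → Fin (nV T) → Set) where

      Touched : List (Fin (nV T)) → Fin (nV T) → Set
      Touched xs y = Any (λ x → Zone x y) xs

      record UpdatedAt (xs : List (Fin (nV T))) (M : Labelling P T) (y : Fin (nV T)) : Set where
        constructor updatedAt
        field
          ifTouched   : Touched xs y → M y ≡ L′ (π y)
          ifUntouched : ¬ Touched xs y → M y ≡ L (π y)

      open UpdatedAt

      Updated : List (Fin (nV T)) → Labelling P T → Set
      Updated xs M = ∀ y → depth y ≤ suc d → UpdatedAt xs M y

      updatedAt-zone : ∀ {x xs M′ y} → Zone x y → M′ y ≡ L′ (π y) → UpdatedAt (x ∷ xs) M′ y
      updatedAt-zone z e = updatedAt (const e) (λ ¬t → contradiction (here z) ¬t)

      updatedAt-outside : ∀ {x xs M M′ y} → ¬ Zone x y → M′ y ≡ M y →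
                          UpdatedAt xs M y → UpdatedAt (x ∷ xs) M′ y
      updatedAt-outside ¬z e upd = updatedAt
        (λ { (here z) → contradiction z ¬z ; (there t) → trans e (ifTouched upd t) })
        (λ ¬t → trans e (ifUntouched upd (¬t ∘ there)))

      untouched-copy-label : ∀ {x xs M} → Copy x → Updated xs M → ¬ Touched xs x → M x ≡ L v
      untouched-copy-label (πx≡v , dx) upd ¬t = trans (ifUntouched (upd _ dx) ¬t) (cong L πx≡v)

      CopiesFire : Set
      CopiesFire = ∀ {x xs M} → Copy x → All Copy xs → x ∉ xs → Updated xs M →
                   ∃ λ M′ → Step P T M M′ × Updated (x ∷ xs) M′

      fire-all : CopiesFire → ∀ {xs M} → Unique xs → All Copy xs → Updated [] M →
                 ∃ λ M′ → Reach P T M M′ × Updated xs M′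
      fire-all fire {[]}     _               _          upd = _ , ε , upd
      fire-all fire {x ∷ xs} (x∉xs ∷ unique) (cx ∷ cxs) upd with fire-all fire unique cxs upd
      ... | M₁ , run , upd₁ with fire cx cxs (All¬⇒¬Any x∉xs) upd₁
      ... | M₂ , step , upd₂ = M₂ , run ◅◅ step ◅ ε , upd₂

      Covered : Set
      Covered = ∀ y → depth y ≤ d → Touched copies y ⊎ (¬ Touched copies y × L′ (π y) ≡ L (π y))

      replay : CopiesFire → Covered → ∀ {M} → Agrees (suc d) L M →
               ∃ λ M′ → Reach P T M M′ × Agrees d L′ M′
      replay fire covered agrees
        with M′ , run , upd ← fire-all fire copies-unique copies-areCopies
                                (λ y dy → updatedAt (λ ()) (λ _ → agrees y dy))
        = M′ , run , agrees′
        where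
        agrees′ : Agrees d L′ M′
        agrees′ y dy with covered y dy
        ... | inj₁ t                = ifTouched (upd y (m≤n⇒m≤1+n dy)) t
        ... | inj₂ (¬t , unchanged) = trans (ifUntouched (upd y (m≤n⇒m≤1+n dy)) ¬t) (sym unchanged)

    module TauReplay {q q′} (δ∈ : (q , tau , q′) ∈ Δ P) (Lv≡q : L v ≡ q) (L′v≡q′ : L′ v ≡ q′)
                     (unchanged : ∀ u → u ≢ v → L′ u ≡ L u) where

      open Firing _≡_

      tauAt : Fin (nV T) → Labelling P T → Labelling P T
      tauAt x M = updateAt M x (const q′)

      tauAt-step : ∀ {x M} → M x ≡ q → Step P T M (tauAt x M)
      tauAt-step {x} {M} Mx≡q =
        x , _ , δ∈ , Mx≡q , updateAt-updates x M , λ u u≢x → updateAt-minimal u x M u≢x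

      fire : CopiesFire
      fire {x} {xs} {M} cx@(πx≡v , _) _ x∉xs upd = tauAt x M , tauAt-step Mx≡q , upd′
        where
        Mx≡q : M x ≡ q
        Mx≡q = trans (untouched-copy-label cx upd (x∉xs ∘ Any.map sym)) Lv≡q

        upd′ : Updated (x ∷ xs) (tauAt x M)
        upd′ y dy with y ≟ x
        ... | yes refl = updatedAt-zone refl (trans (updateAt-updates x M) (sym (trans (cong L′ πx≡v) L′v≡q′)))
        ... | no y≢x   = updatedAt-outside (y≢x ∘ sym) (updateAt-minimal y x M y≢x) (upd y dy)

      covered : Covered
      covered y dy with π y ≟ v
      ... | yes πy≡v = inj₁ (lose (∈-copies⁺ (πy≡v , m≤n⇒m≤1+n dy)) refl)
      ... | no πy≢v  = inj₂ (untouched , unchanged (π y) πy≢v)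
        where
        untouched : ¬ Touched copies y
        untouched t with find t
        ... | _ , x∈ , refl = πy≢v (proj₁ (∈-copies⁻ x∈))

      simulate-tau : ∀ {M} → Agrees (suc d) L M → ∃ λ M′ → Reach P T M M′ × Agrees d L′ M′
      simulate-tau = replay fire covered

    module BroadcastReplay {m q q′} (δ∈ : (q , bcast m , q′) ∈ Δ P)
                           (Lv≡q : L v ≡ q) (L′v≡q′ : L′ v ≡ q′)
                           (neighbours-react : ∀ u → adj Γ v u ≡ true → Reacts P m (L u) (L′ u))
                           (unchanged : ∀ u → u ≢ v → adj Γ v u ≡ false → L′ u ≡ L u) where

      open Firing (λ x y → x ≡ y ⊎ adj T x y ≡ true)

      receiveFrom : Fin (nV T) → Labelling P T → Labelling P T
      receiveFrom x M y = if adj T x y then reactTowards P m (M y) (L′ (π y)) else M y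

      broadcastAt : Fin (nV T) → Labelling P T → Labelling P T
      broadcastAt x M = updateAt (receiveFrom x M) x (const q′)

      broadcastAt-neighbour : ∀ {x M y} → adj T x y ≡ true →
                              broadcastAt x M y ≡ reactTowards P m (M y) (L′ (π y))
      broadcastAt-neighbour {x} {M} {y} xy =
        trans (updateAt-minimal y x (receiveFrom x M) y≢x) (cong (λ b → if b then _ else M y) xy)
        where
        y≢x : y ≢ x
        y≢x refl = not-¬ (T-loopless x) xy

      broadcastAt-silent : ∀ {x M} y → y ≢ x → adj T x y ≡ false → broadcastAt x M y ≡ M y
      broadcastAt-silent {x} {M} y y≢x xy =
        trans (updateAt-minimal y x (receiveFrom x M) y≢x) (cong (λ b → if b then _ else M y) xy)

      broadcastAt-step : ∀ {x M} → M x ≡ q → Step P T M (broadcastAt x M)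
      broadcastAt-step {x} {M} Mx≡q =
        x , _ , δ∈ , Mx≡q , updateAt-updates x (receiveFrom x M) , reacting , broadcastAt-silent
        where
        reacting : ∀ y → adj T x y ≡ true → Reacts P m (M y) (broadcastAt x M y)
        reacting y xy = subst (Reacts P m (M y)) (sym (broadcastAt-neighbour xy)) (reactTowards-reacts P m _ _)

      copy-untouched : ∀ {x xs} → Copy x → All Copy xs → x ∉ xs → ¬ Touched xs x
      copy-untouched cx cxs x∉xs t with find t
      ... | _ , x′∈ , inj₁ refl = x∉xs x′∈
      ... | _ , x′∈ , inj₂ x′x  = copies-nonadjacent (All.lookup cxs x′∈) cx x′x

      untouched-neighbour : ∀ {x xs y} → Copy x → All Copy xs → x ∉ xs → adj T x y ≡ true → ¬ Touched xs y
      untouched-neighbour cx@(πx≡v , dx) cxs x∉xs xy t with find t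
      ... | _ , x′∈ , inj₁ refl = copies-nonadjacent cx (All.lookup cxs x′∈) xy
      ... | _ , x′∈ , inj₂ x′y with πx′≡v , dx′ ← All.lookup cxs x′∈ =
        x∉xs (subst (_∈ _) (sym x≡x′) x′∈)
        where x≡x′ = π-locallyInjective (inRange dx) (inRange dx′) xy x′y (trans πx≡v (sym πx′≡v))

      fire : CopiesFire
      fire {x} {xs} {M} cx@(πx≡v , _) cxs x∉xs upd = broadcastAt x M , broadcastAt-step Mx≡q , upd′
        where
        open ≡-Reasoning
        Mx≡q : M x ≡ q
        Mx≡q = trans (untouched-copy-label cx upd (copy-untouched cx cxs x∉xs)) Lv≡q

        receiver-updated : ∀ {y} → depth y ≤ suc d → adj T x y ≡ true → broadcastAt x M y ≡ L′ (π y)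
        receiver-updated {y} dy xy = begin
          broadcastAt x M y                     ≡⟨ broadcastAt-neighbour xy ⟩
          reactTowards P m (M y) (L′ (π y))     ≡⟨ cong (λ s → reactTowards P m s _) My≡Lπy ⟩
          reactTowards P m (L (π y)) (L′ (π y)) ≡⟨ reactTowards-target P (neighbours-react _ (copy-adjacent cx dy xy)) ⟩
          L′ (π y)                              ∎
          where
          My≡Lπy = UpdatedAt.ifUntouched (upd y dy) (untouched-neighbour cx cxs x∉xs xy)

        upd′ : Updated (x ∷ xs) (broadcastAt x M)
        upd′ y dy with y ≟ x | adj T x y in xy
        ... | yes refl | _     = updatedAt-zone (inj₁ refl)
                                   (trans (updateAt-updates x (receiveFrom x M)) (sym (trans (cong L′ πx≡v) L′v≡q′)))
        ... | no y≢x   | true  = updatedAt-zone (inj₂ xy) (receiver-updated dy xy)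
        ... | no y≢x   | false =
          updatedAt-outside [ y≢x ∘ sym , not-¬ xy ]′ (broadcastAt-silent y y≢x xy) (upd y dy)

      covered : Covered
      covered y dy with π y ≟ v | adj Γ v (π y) in v~πy
      ... | yes πy≡v | _    = inj₁ (lose (∈-copies⁺ (πy≡v , m≤n⇒m≤1+n dy)) (inj₁ refl))
      ... | no _     | true with π-liftsNeighbours (≤-<-trans dy d<K) v~πy
      ...   | x , xy , πx≡v , dx = inj₁ (lose (∈-copies⁺ (πx≡v , ≤-trans dx (s≤s dy))) (inj₂ xy))
      covered y dy | no πy≢v | false = inj₂ (untouched , unchanged (π y) πy≢v v~πy)
        where
        untouched : ¬ Touched copies y
        untouched t with find t
        ... | _ , x∈ , inj₁ refl = πy≢v (proj₁ (∈-copies⁻ x∈))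
        ... | _ , x∈ , inj₂ xy   = not-¬ v~πy (copy-adjacent (∈-copies⁻ x∈) (m≤n⇒m≤1+n dy) xy)

      simulate-broadcast : ∀ {M} → Agrees (suc d) L M → ∃ λ M′ → Reach P T M M′ × Agrees d L′ M′
      simulate-broadcast = replay fire covered

  simulate-step : ∀ {d L L′ M} → d < K → Step P Γ L L′ → Agrees (suc d) L M →
                  ∃ λ M′ → Reach P T M M′ × Agrees d L′ M′
  simulate-step {L = L} {L′} d<K (v , (_ , tau , _) , δ∈ , Lv≡q , L′v≡q′ , unchanged) =
    Replay.TauReplay.simulate-tau d<K L L′ v δ∈ Lv≡q L′v≡q′ unchanged
  simulate-step d<K (v , (_ , recv _ , _) , _ , ())
  simulate-step {L = L} {L′} d<K (v , (_ , bcast _ , _) , δ∈ , Lv≡q , L′v≡q′ , reacting , unchanged) =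
    Replay.BroadcastReplay.simulate-broadcast d<K L L′ v δ∈ Lv≡q L′v≡q′ reacting unchanged

  simulate : ∀ {L L′ M} (run : Reach P Γ L L′) → steps run ≤ K → Agrees (steps run) L M →
             ∃ λ M′ → Reach P T M M′ × Agrees 0 L′ M′
  simulate ε _ agrees = _ , ε , agrees
  simulate (step ◅ run) n<K agrees with simulate-step n<K step agrees
  ... | M₁ , run₁ , agrees₁ with simulate run (<⇒≤ n<K) agrees₁
  ... | M₂ , run₂ , agrees₂ = M₂ , run₁ ◅◅ run₂ , agrees₂

module Unfolding (Γ : Graph) (Γ-symmetric : ∀ u v → adj Γ u v ≡ adj Γ v u) (K : ℕ) (c : Fin (nV Γ)) where

  private
    Vertex = Fin (nV Γ)

  -- The word a_k ∷ … ∷ a₁ ∷ [] stands for the walk c a₁ … a_k: the most recent vertex comes first.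
  endpoint : List Vertex → Vertex
  endpoint []      = c
  endpoint (a ∷ _) = a

  data Walk : List Vertex → Set where
    []    : Walk []
    first : ∀ {a} → adj Γ c a ≡ true → Walk (a ∷ [])
    next  : ∀ {a b r} → Walk (b ∷ r) → adj Γ b a ≡ true → a ≢ endpoint r → Walk (a ∷ b ∷ r)

  walk? : Decidable Walk
  walk? []          = yes []
  walk? (a ∷ [])    = map′ first (λ { (first ca) → ca }) (adj Γ c a ≟ᵇ true)
  walk? (a ∷ b ∷ r) = map′ (λ (w , ba , a≢) → next w ba a≢) (λ { (next w ba a≢) → w , ba , a≢ })
                           (walk? (b ∷ r) ×-dec adj Γ b a ≟ᵇ true ×-dec ¬? (a ≟ endpoint r))

  walk-tail : ∀ {a r} → Walk (a ∷ r) → Walk r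
  walk-tail (first _)    = []
  walk-tail (next w _ _) = w

  walk-lastEdge : ∀ {a r} → Walk (a ∷ r) → adj Γ (endpoint r) a ≡ true
  walk-lastEdge (first ca)    = ca
  walk-lastEdge (next _ ba _) = ba

  data Adjacent : List Vertex → List Vertex → Set where
    parent : ∀ {a r} → Adjacent r (a ∷ r)
    child  : ∀ {a r} → Adjacent (a ∷ r) r

  adjacent-sym : ∀ {r s} → Adjacent r s → Adjacent s r
  adjacent-sym parent = child
  adjacent-sym child  = parent

  walk-adjacent : ∀ {r s} → Walk r → Walk s → Adjacent r s → adj Γ (endpoint r) (endpoint s) ≡ true
  walk-adjacent _  ws parent = walk-lastEdge ws
  walk-adjacent wr _  child  = trans (Γ-symmetric _ _) (walk-lastEdge wr)

  walk-adjacent-injective : ∀ {r r′ s} → Walk r → Walk r′ → Adjacent r s → Adjacent r′ s →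
                            endpoint r ≡ endpoint r′ → r ≡ r′
  walk-adjacent-injective _ _ parent parent _ = refl
  walk-adjacent-injective _ _ child  child  e = cong (_∷ _) e
  walk-adjacent-injective _ (next _ _ a≢) parent child e = contradiction (sym e) a≢
  walk-adjacent-injective (next _ _ a≢) _ child parent e = contradiction e a≢

  walk-lift : ∀ {s u} → Walk s → adj Γ u (endpoint s) ≡ true →
              ∃ λ r → Adjacent r s × endpoint r ≡ u × Walk r × length r ≤ suc (length s)
  walk-lift {[]}    {u} _ uc = u ∷ [] , child , refl , first (trans (Γ-symmetric c u) uc) , ≤-refl
  walk-lift {b ∷ s} {u} w ub with u ≟ endpoint s
  ... | yes refl = s , parent , refl , walk-tail w , m≤n⇒m≤1+n (m≤n⇒m≤1+n ≤-refl)
  ... | no u≢    = u ∷ b ∷ s , child , refl , next w (trans (Γ-symmetric b u) ub) u≢ , ≤-refl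

  -- Words that are not walks are placed below every window of the simulation.
  walkDepth : List Vertex → ℕ
  walkDepth r with walk? r
  ... | yes _ = length r
  ... | no _  = suc K

  walkDepth≤K⇒walk : ∀ r → walkDepth r ≤ K → Walk r
  walkDepth≤K⇒walk r dr with walk? r
  ... | yes w = w
  ... | no _  = contradiction dr 1+n≰n

  walkDepth-walk : ∀ {r} → Walk r → walkDepth r ≡ length r
  walkDepth-walk {r} w with walk? r
  ... | yes _ = refl
  ... | no ¬w = contradiction w ¬w

  words : ℕ → List (List Vertex)
  words zero    = [ [] ]
  words (suc k) = [] ∷ cartesianProductWith _∷_ (allFin _) (words k)

  ∈-words⁺ : ∀ {k} r → length r ≤ k → r ∈ words k
  ∈-words⁺ {zero}  []      _         = here refl
  ∈-words⁺ {suc k} []      _         = here refl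
  ∈-words⁺ {suc k} (a ∷ r) (s≤s len) =
    there (∈-cartesianProductWith⁺ _∷_ (∈-allFin a) (∈-words⁺ r len))

  ∈-words⁻ : ∀ {k r} → r ∈ words k → length r ≤ k
  ∈-words⁻ {zero}  (here refl) = z≤n
  ∈-words⁻ {suc k} (here refl) = z≤n
  ∈-words⁻ {suc k} (there r∈) with ∈-cartesianProductWith⁻ _∷_ (allFin _) (words k) r∈
  ... | _ , _ , _ , r′∈ , refl = s≤s (∈-words⁻ r′∈)

  encode : List Vertex → List ℕ
  encode []      = []
  encode (a ∷ r) = encode r ∷ʳ toℕ a

  encode-injective : ∀ {r s} → encode r ≡ encode s → r ≡ s
  encode-injective {[]}    {[]}    _ = refl
  encode-injective {[]}    {_ ∷ _} e = contradiction (sym e) ∷ʳ≢[]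
  encode-injective {_ ∷ _} {[]}    e = contradiction e ∷ʳ≢[]
  encode-injective {a ∷ r} {b ∷ s} e with ∷ʳ-injective (encode r) (encode s) e
  ... | r≡s , a≡b = cong₂ _∷_ (toℕ-injective a≡b) (encode-injective r≡s)

  encode-prefix : ∀ r u v → u ++ v ≡ encode r → ∃ λ r′ → u ≡ encode r′ × length r′ ≤ length r
  encode-prefix r u v e with initLast v
  ... | [] = r , trans (sym (++-identityʳ u)) e , ≤-refl
  encode-prefix []      u _ e | v ∷ʳ′ b = contradiction (trans (++-assoc u v [ b ]) e) ∷ʳ≢[]
  encode-prefix (a ∷ r) u _ e | v ∷ʳ′ b
    with r′ , u≡ , len ← encode-prefix r u v (∷ʳ-injectiveˡ (u ++ v) (encode r) (trans (++-assoc u v [ b ]) e))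
    = r′ , u≡ , m≤n⇒m≤1+n len

  isChildOf-encode⇒adjacent : ∀ r s → isChildOf (encode r) (encode s) ≡ true → Adjacent r s
  isChildOf-encode⇒adjacent r s isChild with isChildOf⇒∷ʳ (encode r) (encode s) isChild
  isChildOf-encode⇒adjacent []      s _ | _ , e = contradiction (sym e) ∷ʳ≢[]
  isChildOf-encode⇒adjacent (a ∷ r) s _ | _ , e
    with refl ← encode-injective {r} {s} (∷ʳ-injectiveˡ (encode r) (encode s) e) = child

  adjacent⇒isChildOf-encode : ∀ {r s} → Adjacent r s →
                              isChildOf (encode r) (encode s) ∨ isChildOf (encode s) (encode r) ≡ true
  adjacent⇒isChildOf-encode {r} {a ∷ r} parent =
    trans (cong (isChildOf (encode r) (encode (a ∷ r)) ∨_) (isChildOf-∷ʳ (encode r) (toℕ a))) (∨-zeroʳ _)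
  adjacent⇒isChildOf-encode {a ∷ s} {s} child =
    cong (_∨ isChildOf (encode s) (encode (a ∷ s))) (isChildOf-∷ʳ (encode s) (toℕ a))

  shortWords : List (List Vertex)
  shortWords = deduplicate (≡-decᴸ _≟_) (words K)

  ∈-shortWords⁺ : ∀ {r} → length r ≤ K → r ∈ shortWords
  ∈-shortWords⁺ {r} len = ∈-deduplicate⁺ (≡-decᴸ _≟_) (∈-words⁺ r len)

  ∈-shortWords⁻ : ∀ {r} → r ∈ shortWords → length r ≤ K
  ∈-shortWords⁻ r∈ = ∈-words⁻ (∈-deduplicate⁻ (≡-decᴸ _≟_) (words K) r∈)

  encodedShortWords-prefixClosed : ∀ w → w ∈ map encode shortWords →
                                   ∀ u v → w ≡ u ++ v → u ∈ map encode shortWords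
  encodedShortWords-prefixClosed w w∈ u v w≡uv with r , r∈ , w≡ ← ∈-map⁻ encode w∈
    with r′ , u≡ , len ← encode-prefix r u v (trans (sym w≡uv) w≡)
    = subst (_∈ map encode shortWords) (sym u≡)
            (∈-map⁺ encode (∈-shortWords⁺ {r′} (≤-trans len (∈-shortWords⁻ r∈))))

  vertices : TreeVertices
  vertices = record
    { V            = map encode shortWords
    ; unique       = map⁺ encode-injective (UniqueDec.deduplicate-! (≡-decᴸ _≟_) (words K))
    ; hasRoot      = ∈-map⁺ encode (∈-shortWords⁺ {[]} z≤n)
    ; prefixClosed = encodedShortWords-prefixClosed
    }

  tree : Graph
  tree = treeTopology vertices

  word : Fin (nV tree) → List Vertex
  word i = proj₁ (∈-map⁻ encode (∈-lookup {xs = V vertices} i))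

  lookup-word : ∀ i → lookup (V vertices) i ≡ encode (word i)
  lookup-word i = proj₂ (proj₂ (∈-map⁻ encode (∈-lookup {xs = V vertices} i)))

  word-injective : ∀ {i j} → word i ≡ word j → i ≡ j
  word-injective {i} {j} e =
    lookup-injective (unique vertices) i j (trans (lookup-word i) (trans (cong encode e) (sym (lookup-word j))))

  word-surjective : ∀ r → length r ≤ K → ∃ λ i → word i ≡ r
  word-surjective r len =
    index r∈ , encode-injective (trans (sym (lookup-word (index r∈))) (sym (lookup-index r∈)))
    where r∈ = ∈-map⁺ encode (∈-shortWords⁺ {r} len)

  tree-adj : ∀ i j → adj tree i j ≡
             isChildOf (encode (word i)) (encode (word j)) ∨ isChildOf (encode (word j)) (encode (word i))
  tree-adj i j = cong₂ (λ w w′ → isChildOf w w′ ∨ isChildOf w′ w) (lookup-word i) (lookup-word j)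

  tree-adjacent⁻ : ∀ {i j} → adj tree i j ≡ true → Adjacent (word i) (word j)
  tree-adjacent⁻ {i} {j} ij with ∨≡true⁻ _ _ (trans (sym (tree-adj i j)) ij)
  ... | inj₁ isChild = isChildOf-encode⇒adjacent _ _ isChild
  ... | inj₂ isChild = adjacent-sym (isChildOf-encode⇒adjacent _ _ isChild)

  tree-adjacent⁺ : ∀ {i j} → Adjacent (word i) (word j) → adj tree i j ≡ true
  tree-adjacent⁺ {i} {j} ij = trans (tree-adj i j) (adjacent⇒isChildOf-encode ij)

  walkTreeCover : BoundedCover K tree Γ
  walkTreeCover = record
    { π                  = endpoint ∘ word
    ; depth              = walkDepth ∘ word
    ; π-adjacent         = λ {x} {y} dx dy xy →
        walk-adjacent (walkDepth≤K⇒walk (word x) dx) (walkDepth≤K⇒walk (word y) dy) (tree-adjacent⁻ xy)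
    ; π-locallyInjective = λ {x} {x′} dx dx′ xy x′y πx≡πx′ → word-injective
        (walk-adjacent-injective (walkDepth≤K⇒walk (word x) dx) (walkDepth≤K⇒walk (word x′) dx′)
                                 (tree-adjacent⁻ xy) (tree-adjacent⁻ x′y) πx≡πx′)
    ; π-liftsNeighbours  = liftsNeighbours
    }
    where
    liftsNeighbours : ∀ {y u} → walkDepth (word y) < K → adj Γ u (endpoint (word y)) ≡ true →
                      ∃ λ x → adj tree x y ≡ true × endpoint (word x) ≡ u ×
                              walkDepth (word x) ≤ suc (walkDepth (word y))
    liftsNeighbours {y} dy uy
      with wy ← walkDepth≤K⇒walk (word y) (<⇒≤ dy)
      with r , ry , r-end , wr , len ← walk-lift wy uy
      with x , refl ← word-surjective r (≤-trans len (subst (_< K) (walkDepth-walk wy) dy))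
      = x , tree-adjacent⁺ ry , r-end
          , subst₂ _≤_ (sym (walkDepth-walk wr)) (cong suc (sym (walkDepth-walk wy))) len

  root : ∃ λ x → endpoint (word x) ≡ c × walkDepth (word x) ≡ 0
  root with x , x↦[] ← word-surjective [] z≤n =
    x , cong endpoint x↦[] , trans (cong walkDepth x↦[]) (walkDepth-walk [])

trees⇒graphs : ∀ {P qf} → CoverTrees P qf → CoverGraphs P qf
trees⇒graphs (T , coverable) = treeTopology T , treeTopology-isTopology T , coverable

graphs⇒trees : ∀ {P qf} → CoverGraphs P qf → CoverTrees P qf
graphs⇒trees {P} {qf} (Γ , (Γ-symmetric , Γ-loopless) , L′ , run , c , L′c≡qf) =
  let open Unfolding Γ Γ-symmetric (steps run) c
      open Simulation P walkTreeCover (proj₂ (treeTopology-isTopology vertices)) Γ-loopless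
      (M′ , run′ , agrees) = simulate run ≤-refl (λ _ _ → refl)
      (x , x-end , x-depth) = root
      open ≡-Reasoning
  in vertices , M′ , run′ , x , (begin
       M′ x                   ≡⟨ agrees x (≤-reflexive x-depth) ⟩
       L′ (endpoint (word x)) ≡⟨ cong L′ x-end ⟩
       L′ c                   ≡⟨ L′c≡qf ⟩
       qf                     ∎)

mainTheorem1 : (P : Protocol) (qf : Fin (nQ P)) → CoverGraphs P qf ⇔ CoverTrees P qf
mainTheorem1 P qf = mk⇔ graphs⇒trees trees⇒graphs
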